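{- Let $G$ be a graph, $(T,\delta)$ a rooted layout of $G$, $x$ a node of $T$ and $R'\subseteq\overline{V_x}$. If $X\subseteq V_x$ is $R'$-important, then $G[X]$ is a forest and: (1) for every pair of distinct vertices $a,b\in X^{2+}$, $N(a)\cap\overline{V_x}\neq N(b)\cap\overline{V_x}$; (2) $|X^{2+}|$ is at most each of $2\mathsf{mim}(V_x)$, $2\mathsf{rw}(V_x)$, $2\mathsf{rw}_\mathbb{Q}(V_x)$ and $2\log_2(\mathsf{nec}_1(V_x))$.
   Context: A rooted layout of $G$ is a pair $(T,\delta)$ with $T$ a rooted binary tree and $\delta$ a bijection between $V(G)$ and the leaves of $T$; $V_x$ is the set of vertices $v$ such that the root-to-$\delta(v)$ path contains $x$, and $\overline{V_x}=V(G)\setminus V_x$. For $S\subseteq V(G)$ and $d\in\mathbb{N}^+$, $X,Y\subseteq S$ satisfy $X\equiv^d_S Y$ if $\min(d,|X\cap N(u)|)=\min(d,|Y\cap N(u)|)$ for all $u\in V(G)\setminus S$; $\mathsf{nec}_1(S)$ is the number of classes of $\equiv^1_S$. $X\subseteq V_x$ is $R'$-important if there exists $Y\subseteq\overline{V_x}$ with $Y\equiv^2_{\overline{V_x}}R'$ such that $G[X\cup Y]$ is a tree. $X^{2+}:=\{v\in X:|N(v)\cap R'|\ge 2\}$. For $S\subseteq V(G)$: $\mathsf{mim}(S)$ is the maximum size of an induced matching in the bipartite graph formed by the edges between $S$ and $V(G)\setminus S$; $\mathsf{rw}(S)$, $\mathsf{rw}_\mathbb{Q}(S)$ are the ranks over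 $GF(2)$, $\mathbb{Q}$ of the adjacency matrix between $S$ and $V(G)\setminus S$. -}

module Defs where

open import Data.Nat using (ℕ; zero; suc; _+_; _*_; _⊓_; _≤_; _^_)
open import Data.Bool using (Bool; true; false; _∧_; _xor_; if_then_else_)
open import Data.Fin using (Fin; zero; suc; inject₁; fromℕ)
open import Data.Fin.Subset using (Subset; _∈_; _∉_; _⊆_; ∁; _∩_; _∪_; ∣_∣; ⁅_⁆)
open import Data.Vec using (tabulate; lookup)
open import Data.List using (List; []; _∷_; _++_)
open import Data.List.Relation.Unary.Unique.Propositional using (Unique)
open import Data.List.Membership.Propositional using () renaming (_∈_ to _∈ₗ_)
open import Data.Product using (Σ; _×_; ∃)
open import Relation.Nullary using (¬_)
open import Relation.Binary.PropositionalEquality using (_≡_; _≢_)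
open import Data.Rational using (ℚ; 0ℚ; 1ℚ) renaming (_+_ to _+ℚ_; _*_ to _*ℚ_)

record Graph (n : ℕ) : Set where
  field
    adj    : Fin n → Fin n → Bool
    sym    : ∀ u v → adj u v ≡ adj v u
    irrefl : ∀ v → adj v v ≡ false
open Graph public

N : ∀ {n} → Graph n → Fin n → Subset n
N G u = tabulate (adj G u)

-- rooted binary trees whose leaves carry a vertex (the map δ⁻¹)
data Tree (n : ℕ) : Set where
  leaf : Fin n → Tree n
  node : Tree n → Tree n → Tree n

leaves : ∀ {n} → Tree n → List (Fin n)
leaves (leaf v)   = v ∷ []
leaves (node l r) = leaves l ++ leaves r

-- a rooted layout: δ is a bijection between V(G) and the leaves of T,
-- i.e. every vertex labels exactly one leaf
record Layout (n : ℕ) : Set where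
  field
    tree    : Tree n
    unique  : Unique (leaves tree)
    covers  : ∀ v → v ∈ₗ leaves tree
open Layout public

data Node {n : ℕ} : Tree n → Set where
  root  : ∀ {t} → Node t
  left  : ∀ {l r} → Node l → Node (node l r)
  right : ∀ {l r} → Node r → Node (node l r)

subtree : ∀ {n} {t : Tree n} → Node t → Tree n
subtree {t = t} root = t
subtree (left x)  = subtree x
subtree (right x) = subtree x

leafSet : ∀ {n} → Tree n → Subset n
leafSet (leaf v)   = ⁅ v ⁆
leafSet (node l r) = leafSet l ∪ leafSet r

-- V_x : the vertices v whose leaf δ(v) lies below x (root-to-δ(v) path contains x)
V : ∀ {n} (L : Layout n) → Node (tree L) → Subset n
V L x = leafSet (subtree x)

record Cycle {n : ℕ} (G : Graph n) (S : Subset n) : Set where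
  field
    len   : ℕ
    c     : Fin (3 + len) → Fin n
    inj   : ∀ i j → c i ≡ c j → i ≡ j
    inS   : ∀ i → c i ∈ S
    step  : ∀ (i : Fin (2 + len)) → adj G (c (inject₁ i)) (c (suc i)) ≡ true
    close : adj G (c (fromℕ (2 + len))) (c zero) ≡ true

data Walk {n : ℕ} (G : Graph n) (S : Subset n) : Fin n → Fin n → Set where
  stop : ∀ {a} → a ∈ S → Walk G S a a
  step : ∀ {a b c} → a ∈ S → adj G a b ≡ true → Walk G S b c → Walk G S a c

IsForest : ∀ {n} → Graph n → Subset n → Set
IsForest G S = ¬ Cycle G S

Connected : ∀ {n} → Graph n → Subset n → Set
Connected G S = ∀ a b → a ∈ S → b ∈ S → Walk G S a b

IsTree : ∀ {n} → Graph n → Subset n → Set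
IsTree G S = Connected G S × IsForest G S

NeqEquiv : ∀ {n} → Graph n → ℕ → Subset n → Subset n → Subset n → Set
NeqEquiv G d S X Y = ∀ u → u ∉ S → d ⊓ ∣ X ∩ N G u ∣ ≡ d ⊓ ∣ Y ∩ N G u ∣

-- nec₁(S) = k : k is the number of classes of ≡^1_S on subsets of S
IsNec1 : ∀ {n} → Graph n → Subset n → ℕ → Set
IsNec1 {n} G S k =
  Σ (Fin k → Subset n) λ rep →
      (∀ i → rep i ⊆ S)
    × (∀ i j → NeqEquiv G 1 S (rep i) (rep j) → i ≡ j)
    × (∀ X → X ⊆ S → ∃ λ i → NeqEquiv G 1 S X (rep i))

Important : ∀ {n} (G : Graph n) (L : Layout n) → Node (tree L) → Subset n → Subset n → Set
Important {n} G L x R' X =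
  X ⊆ V L x ×
  Σ (Subset n) λ Y → Y ⊆ ∁ (V L x) × NeqEquiv G 2 (∁ (V L x)) Y R' × IsTree G (X ∪ Y)

X2+ : ∀ {n} → Graph n → Subset n → Subset n → Subset n
X2+ G R' X = tabulate λ v → lookup X v ∧ twoOrMore ∣ N G v ∩ R' ∣
  where
    twoOrMore : ℕ → Bool
    twoOrMore (suc (suc _)) = true
    twoOrMore _             = false

InducedMatching : ∀ {n} → Graph n → Subset n → ℕ → Set
InducedMatching {n} G S k =
  Σ (Fin k → Fin n) λ a → Σ (Fin k → Fin n) λ b →
      (∀ i → a i ∈ S) × (∀ i → b i ∉ S)
    × (∀ i → adj G (a i) (b i) ≡ true)
    × (∀ i j → i ≢ j → adj G (a i) (b j) ≡ false)

IsMim : ∀ {n} → Graph n → Subset n → ℕ → Set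
IsMim G S m = InducedMatching G S m × (∀ k → InducedMatching G S k → k ≤ m)

-- ranks of the adjacency matrix M_S = (adj v w)_{v ∈ S, w ∉ S}
-- rank = maximum number of linearly independent rows

bigop : ∀ {A : Set} {n} → (A → A → A) → A → (Fin n → A) → A
bigop {n = zero}  _∙_ e f = e
bigop {n = suc n} _∙_ e f = f zero ∙ bigop _∙_ e (λ i → f (suc i))

IndepGF2 : ∀ {n} → Graph n → Subset n → Subset n → Set
IndepGF2 G S R =
  R ⊆ S ×
  (∀ (c : Fin _ → Bool) →
     (∀ w → w ∉ S → bigop _xor_ false (λ v → c v ∧ lookup R v ∧ adj G v w) ≡ false) →
     ∀ v → v ∈ R → c v ≡ false)

Indepℚ : ∀ {n} → Graph n → Subset n → Subset n → Set
Indepℚ G S R =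
  R ⊆ S ×
  (∀ (c : Fin _ → ℚ) →
     (∀ w → w ∉ S →
        bigop _+ℚ_ 0ℚ (λ v → if lookup R v ∧ adj G v w then c v else 0ℚ) ≡ 0ℚ) →
     ∀ v → v ∈ R → c v ≡ 0ℚ)

IsRw : ∀ {n} → Graph n → Subset n → ℕ → Set
IsRw G S r = (Σ (Subset _) λ R → IndepGF2 G S R × ∣ R ∣ ≡ r)
           × (∀ R → IndepGF2 G S R → ∣ R ∣ ≤ r)

IsRwℚ : ∀ {n} → Graph n → Subset n → ℕ → Set
IsRwℚ G S r = (Σ (Subset _) λ R → Indepℚ G S R × ∣ R ∣ ≡ r)
            × (∀ R → Indepℚ G S R → ∣ R ∣ ≤ r)

-- Let X ⊆ V_x be R'-important, witnessed by Y ⊆ V̄_x with Y ≡²_{V̄_x} R' and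
-- G[X ∪ Y] a tree.  G[X] is a forest as an induced subgraph of a tree.
-- Since Y ≡² R' on V_x, every vertex of A := X^{2+} has two neighbours in Y.
--
-- (1) Two vertices a ≠ b of A with the same neighbourhood in V̄_x have two
--     common neighbours in Y, which gives a 4-cycle in G[X ∪ Y].
-- (2) The heart of the proof is a purely graph-theoretic fact: if G[S] is a
--     forest, A, Y ⊆ S, and every vertex of A has two neighbours in Y, then
--     there is an induced matching between A and Y with at least |A|/2 edges.
--     It is proved by peeling off one matching edge at a time while removing
--     at most two vertices of A; when no vertex can be peeled off cheaply, a
--     subgraph of minimum degree two would appear, contradicting acyclicity.
--     Since A ⊆ V_x and Y ⊆ V̄_x, such a matching is an induced matching of
--     the cut (V_x, V̄_x), and an induced matching of size m yields
--     mim ≥ m, rw ≥ m, rw_ℚ ≥ m and nec₁ ≥ 2^m.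
module Submission where

open import Defs renaming (sym to adj-sym)
open import Data.Nat using (ℕ; zero; suc; _+_; _*_; _≤_; _<_; _<?_; _^_; _⊓_; z≤n; s≤s)
open import Data.Nat.Properties
open import Data.Nat.Induction using (<-rec)
open import Data.Bool using (Bool; true; false; _∧_; _xor_; if_then_else_)
open import Data.Bool.Properties using (¬-not; ∧-zeroʳ; ∧-identityʳ)
open import Data.Fin using (Fin; zero; suc; toℕ; inject₁; funToFin; finToFun; combine)
  renaming (_≟_ to _≟F_)
open import Data.Fin.Properties
  using (any?; pigeonhole; injective⇒≤; toℕ-injective; toℕ-inject₁; toℕ-fromℕ;
         funToFin-finToFin; toℕ<n) renaming (suc-injective to fsuc-injective; 0≢1+n to fzero≢fsuc)
open import Data.Fin.Subset
  using (Subset; _∈_; _∉_; _⊆_; ∁; _∩_; _∪_; _-_; ∣_∣; ⁅_⁆; ⊥; Nonempty; Empty)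
open import Data.Fin.Subset.Properties
  using (_∈?_; nonempty?; Empty-unique; ∣⊥∣≡0; ∉⊥; x∈⁅x⁆; x∈⁅y⁆⇒x≡y; ∣⁅x⁆∣≡1;
         p⊆q⇒∣p∣≤∣q∣; x∈p∩q⁺; x∈p∩q⁻; x∈p∪q⁻; p⊆p∪q; q⊆p∪q;
         x∈p⇒∣p-x∣<∣p∣; x∈p∧x≢y⇒x∈p-y; p∩q⊆p; ⊆-trans; x∈p⇒x∉∁p; x∈∁p⇒x∉p; ∩-comm)
open import Data.Vec using ([]; _∷_; lookup; tabulate)
open import Data.Vec.Properties using (lookup∘tabulate; []=⇒lookup; lookup⇒[]=)
open import Data.Product using (∃; ∃₂; _×_; _,_; proj₁; proj₂)
open import Data.Sum using (_⊎_; inj₁; inj₂) renaming (map to map-⊎)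
open import Data.Empty using (⊥-elim)
open import Function using (_$_; _∘_; case_of_)
open import Data.Rational using (0ℚ) renaming (_+_ to _+ℚ_)
import Data.Rational.Properties as ℚ
open import Relation.Nullary using (¬_; Dec; yes; no; does; contradiction)
open import Relation.Nullary.Decidable using (_×-dec_; ¬?; dec-true)
open import Relation.Unary using (Decidable)
open import Relation.Binary.Definitions using (tri<; tri≈; tri>)
open import Relation.Binary.PropositionalEquality

private
  variable
    n : ℕ

∈-tabulate⁺ : {f : Fin n → Bool} {v : Fin n} → f v ≡ true → v ∈ tabulate f
∈-tabulate⁺ {f = f} {v} fv = lookup⇒[]= v (tabulate f) (trans (lookup∘tabulate f v) fv)

∈-tabulate⁻ : {f : Fin n → Bool} {v : Fin n} → v ∈ tabulate f → f v ≡ true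
∈-tabulate⁻ {f = f} {v} v∈ = trans (sym (lookup∘tabulate f v)) ([]=⇒lookup v∈)

does-true : ∀ {A : Set} (a? : Dec A) → does a? ≡ true → A
does-true (yes a) _ = a

⟦_⟧ : {P : Fin n → Set} → Decidable P → Subset n
⟦ P? ⟧ = tabulate (λ v → does (P? v))

∈⟦⟧⁺ : {P : Fin n → Set} {P? : Decidable P} {v : Fin n} → P v → v ∈ ⟦ P? ⟧
∈⟦⟧⁺ {P? = P?} {v} pv = ∈-tabulate⁺ (dec-true (P? v) pv)

∈⟦⟧⁻ : {P : Fin n → Set} {P? : Decidable P} {v : Fin n} → v ∈ ⟦ P? ⟧ → P v
∈⟦⟧⁻ {P? = P?} {v} v∈ = does-true (P? v) (∈-tabulate⁻ v∈)

∩-monoˡ : {p q r : Subset n} → p ⊆ q → p ∩ r ⊆ q ∩ r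
∩-monoˡ {p = p} {r = r} p⊆q v∈ =
  let (v∈p , v∈r) = x∈p∩q⁻ p r v∈ in x∈p∩q⁺ (p⊆q v∈p , v∈r)

∣p∪q∣≤∣p∣+∣q∣ : (p q : Subset n) → ∣ p ∪ q ∣ ≤ ∣ p ∣ + ∣ q ∣
∣p∪q∣≤∣p∣+∣q∣ []          []          = z≤n
∣p∪q∣≤∣p∣+∣q∣ (true ∷ p)  (true ∷ q)  =
  s≤s (≤-trans (∣p∪q∣≤∣p∣+∣q∣ p q) (+-monoʳ-≤ ∣ p ∣ (n≤1+n ∣ q ∣)))
∣p∪q∣≤∣p∣+∣q∣ (true ∷ p)  (false ∷ q) = s≤s (∣p∪q∣≤∣p∣+∣q∣ p q)
∣p∪q∣≤∣p∣+∣q∣ (false ∷ p) (true ∷ q)  =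
  subst (suc ∣ p ∪ q ∣ ≤_) (sym (+-suc ∣ p ∣ ∣ q ∣)) (s≤s (∣p∪q∣≤∣p∣+∣q∣ p q))
∣p∪q∣≤∣p∣+∣q∣ (false ∷ p) (false ∷ q) = ∣p∪q∣≤∣p∣+∣q∣ p q

Empty⇒∣p∣≡0 : {p : Subset n} → Empty p → ∣ p ∣ ≡ 0
Empty⇒∣p∣≡0 {n} empty = trans (cong ∣_∣ (Empty-unique empty)) (∣⊥∣≡0 n)

∈⇒1≤∣p∣ : {p : Subset n} {v : Fin n} → v ∈ p → 1 ≤ ∣ p ∣
∈⇒1≤∣p∣ {v = v} v∈p =
  subst (_≤ _) (∣⁅x⁆∣≡1 v) (p⊆q⇒∣p∣≤∣q∣ λ u∈ → subst (_∈ _) (sym (x∈⁅y⁆⇒x≡y v u∈)) v∈p)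

HasTwo : Subset n → Set
HasTwo p = ∃₂ λ u v → u ≢ v × u ∈ p × v ∈ p

HasTwo? : (p : Subset n) → Dec (HasTwo p)
HasTwo? p = any? λ u → any? λ v → ¬? (u ≟F v) ×-dec (u ∈? p) ×-dec (v ∈? p)

HasTwo-mono : {p q : Subset n} → p ⊆ q → HasTwo p → HasTwo q
HasTwo-mono p⊆q (u , v , u≢v , u∈ , v∈) = u , v , u≢v , p⊆q u∈ , p⊆q v∈

other : {p : Subset n} → HasTwo p → (z : Fin n) → ∃ λ u → u ∈ p × u ≢ z
other (u , v , u≢v , u∈ , v∈) z with u ≟F z
... | yes refl = v , v∈ , λ v≡u → u≢v (sym v≡u)
... | no u≢z   = u , u∈ , u≢z

¬HasTwo⇒∣p∣≤1 : {p : Subset n} → ¬ HasTwo p → ∣ p ∣ ≤ 1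
¬HasTwo⇒∣p∣≤1 {n} {p} ¬two with nonempty? p
... | no  empty      = subst (_≤ 1) (sym (Empty⇒∣p∣≡0 empty)) z≤n
... | yes (v , v∈p)  = subst (_ ≤_) (∣⁅x⁆∣≡1 v) (p⊆q⇒∣p∣≤∣q∣ p⊆⁅v⁆)
  where
    p⊆⁅v⁆ : p ⊆ ⁅ v ⁆
    p⊆⁅v⁆ {u} u∈p with u ≟F v
    ... | yes refl = x∈⁅x⁆ u
    ... | no u≢v   = contradiction (u , v , u≢v , u∈p , v∈p) ¬two

2≤∣p∣⇒HasTwo : {p : Subset n} → 2 ≤ ∣ p ∣ → HasTwo p
2≤∣p∣⇒HasTwo {p = p} 2≤∣p∣ with HasTwo? p
... | yes two = two
... | no ¬two  = contradiction (¬HasTwo⇒∣p∣≤1 ¬two) (<⇒≱ 2≤∣p∣)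

injection⇒≤∣p∣ : ∀ {m} {p : Subset n} (a : Fin m → Fin n) →
  (∀ i j → a i ≡ a j → i ≡ j) → (∀ i → a i ∈ p) → m ≤ ∣ p ∣
injection⇒≤∣p∣ {m = zero}  a inj a∈ = z≤n
injection⇒≤∣p∣ {m = suc m} {p} a inj a∈ =
  ≤-trans (s≤s (injection⇒≤∣p∣ (λ i → a (suc i)) inj-suc a∈-rest)) (x∈p⇒∣p-x∣<∣p∣ (a∈ zero))
  where
    inj-suc : ∀ i j → a (suc i) ≡ a (suc j) → i ≡ j
    inj-suc i j eq = fsuc-injective (inj (suc i) (suc j) eq)
    a∈-rest : ∀ i → a (suc i) ∈ p - a zero
    a∈-rest i = x∈p∧x≢y⇒x∈p-y (a∈ (suc i)) (λ eq → fzero≢fsuc (sym (inj (suc i) zero eq)))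

Kept : Subset n → Fin n → Subset n → Fin n → Set
Kept p a W b = b ∈ p × b ≢ a × b ∉ W

kept? : (p : Subset n) (a : Fin n) (W : Subset n) → Decidable (Kept p a W)
kept? p a W b = (b ∈? p) ×-dec ¬? (b ≟F a) ×-dec ¬? (b ∈? W)

remove : Subset n → Fin n → Subset n → Subset n
remove p a W = ⟦ kept? p a W ⟧

remove⁺ : {p W : Subset n} {a b : Fin n} → b ∈ p → b ≢ a → b ∉ W → b ∈ remove p a W
remove⁺ {p = p} {W} {a} b∈p b≢a b∉W = ∈⟦⟧⁺ {P? = kept? p a W} (b∈p , b≢a , b∉W)

remove⁻ : (p W : Subset n) {a b : Fin n} → b ∈ remove p a W → Kept p a W b
remove⁻ p W {a} = ∈⟦⟧⁻ {P? = kept? p a W}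

remove-< : {p W : Subset n} {a : Fin n} → a ∈ p → ∣ remove p a W ∣ < ∣ p ∣
remove-< {p = p} {W} {a} a∈p = ≤-<-trans {j = ∣ p - a ∣}
  (p⊆q⇒∣p∣≤∣q∣ λ b∈ → let (b∈p , b≢a , _) = remove⁻ p W b∈ in x∈p∧x≢y⇒x∈p-y b∈p b≢a)
  (x∈p⇒∣p-x∣<∣p∣ a∈p)

remove-≤ : {p W : Subset n} (a : Fin n) → ∣ W ∣ ≤ 1 → ∣ p ∣ ≤ ∣ remove p a W ∣ + 2
remove-≤ {p = p} {W} a ∣W∣≤1 = begin
  ∣ p ∣                                ≤⟨ p⊆q⇒∣p∣≤∣q∣ cover ⟩
  ∣ remove p a W ∪ (⁅ a ⁆ ∪ W) ∣       ≤⟨ ∣p∪q∣≤∣p∣+∣q∣ (remove p a W) _ ⟩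
  ∣ remove p a W ∣ + ∣ ⁅ a ⁆ ∪ W ∣     ≤⟨ +-monoʳ-≤ _ (∣p∪q∣≤∣p∣+∣q∣ ⁅ a ⁆ W) ⟩
  ∣ remove p a W ∣ + (∣ ⁅ a ⁆ ∣ + ∣ W ∣)
                                       ≡⟨ cong (λ k → ∣ remove p a W ∣ + (k + ∣ W ∣)) (∣⁅x⁆∣≡1 a) ⟩
  ∣ remove p a W ∣ + suc ∣ W ∣         ≤⟨ +-monoʳ-≤ _ (s≤s ∣W∣≤1) ⟩
  ∣ remove p a W ∣ + 2                 ∎
  where
    open ≤-Reasoning
    cover : p ⊆ remove p a W ∪ (⁅ a ⁆ ∪ W)
    cover {b} b∈p with b ≟F a | b ∈? W
    ... | yes refl | _       = q⊆p∪q _ _ (p⊆p∪q W (x∈⁅x⁆ b))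
    ... | no _     | yes b∈W = q⊆p∪q _ _ (q⊆p∪q _ W b∈W)
    ... | no b≢a   | no b∉W  = p⊆p∪q _ (remove⁺ b∈p b≢a b∉W)

collision-free⇒injective : ∀ {m} {A : Set} (f : Fin m → A) →
  (∀ s t → toℕ s < toℕ t → f s ≢ f t) → ∀ s t → f s ≡ f t → s ≡ t
collision-free⇒injective f free s t fs≡ft with <-cmp (toℕ s) (toℕ t)
... | tri< s<t _ _ = contradiction fs≡ft (free s t s<t)
... | tri≈ _ s≡t _ = toℕ-injective s≡t
... | tri> _ _ t<s = contradiction (sym fs≡ft) (free t s t<s)

module _ (G : Graph n) where

  ∈N⁺ : {u v : Fin n} → adj G u v ≡ true → v ∈ N G u
  ∈N⁺ = ∈-tabulate⁺

  ∈N⁻ : {u v : Fin n} → v ∈ N G u → adj G u v ≡ true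
  ∈N⁻ = ∈-tabulate⁻

  ∈N-sym : {u v : Fin n} → v ∈ N G u → u ∈ N G v
  ∈N-sym {u} {v} v∈Nu = ∈N⁺ (trans (adj-sym G v u) (∈N⁻ v∈Nu))

  adj⇒≢ : {u v : Fin n} → adj G u v ≡ true → u ≢ v
  adj⇒≢ {u} uv refl with trans (sym uv) (irrefl G u)
  ... | ()

  adj-cong : {u u' v v' : Fin n} → u ≡ u' → v ≡ v' → adj G u v ≡ true → adj G u' v' ≡ true
  adj-cong refl refl uv = uv

-- A nonempty set P ⊆ S in which every vertex has two neighbours inside P
-- yields a cycle of G[S]: follow a walk in P that never immediately turns
-- back; by pigeonhole it revisits a vertex, and the first stretch between
-- two visits of a vertex without an inner repetition is a cycle.

module MinimumDegreeTwo (G : Graph n) (S P : Subset n) (P⊆S : P ⊆ S)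
  (twoNbrs : ∀ {v} → v ∈ P → HasTwo (P ∩ N G v)) where

  record Arc : Set where
    field
      tail head : Fin n
      tail∈P    : tail ∈ P
      head∈P    : head ∈ P
      adjacent  : adj G tail head ≡ true
  open Arc

  continue : (e : Arc) → ∃ λ w → w ∈ P ∩ N G (head e) × w ≢ tail e
  continue e = other (twoNbrs (head∈P e)) (tail e)

  next : Arc → Arc
  next e = record
    { tail     = head e
    ; head     = proj₁ (continue e)
    ; tail∈P   = head∈P e
    ; head∈P   = proj₁ (x∈p∩q⁻ P _ (proj₁ (proj₂ (continue e))))
    ; adjacent = ∈N⁻ G (proj₂ (x∈p∩q⁻ P _ (proj₁ (proj₂ (continue e)))))
    }

  module NonBacktrackingWalk (v₀ : Fin n) (v₀∈P : v₀ ∈ P) where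

    first : Arc
    first with twoNbrs v₀∈P
    ... | (u , _ , _ , u∈ , _) = record
      { tail = v₀ ; head = u ; tail∈P = v₀∈P
      ; head∈P = proj₁ (x∈p∩q⁻ P _ u∈) ; adjacent = ∈N⁻ G (proj₂ (x∈p∩q⁻ P _ u∈)) }

    arcs : ℕ → Arc
    arcs zero    = first
    arcs (suc k) = next (arcs k)

    walk : ℕ → Fin n
    walk k = tail (arcs k)

    walk∈S : ∀ k → walk k ∈ S
    walk∈S k = P⊆S (tail∈P (arcs k))

    walk-adj : ∀ k → adj G (walk k) (walk (suc k)) ≡ true
    walk-adj k = adjacent (arcs k)

    no-backtrack : ∀ k → walk (suc (suc k)) ≢ walk k
    no-backtrack k = proj₂ (proj₂ (continue (arcs k)))

    walk-adj-at : ∀ i j → j ≡ suc i → adj G (walk i) (walk j) ≡ true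
    walk-adj-at i j refl = walk-adj i

    segment-cycle : ∀ a len → walk a ≡ walk (a + (3 + len)) →
      (∀ (s t : Fin (3 + len)) → walk (a + toℕ s) ≡ walk (a + toℕ t) → s ≡ t) → Cycle G S
    segment-cycle a len closed injective = record
      { len   = len
      ; c     = λ t → walk (a + toℕ t)
      ; inj   = injective
      ; inS   = λ t → walk∈S (a + toℕ t)
      ; step  = λ i → walk-adj-at _ _
                  (trans (+-suc a (toℕ i)) (cong (λ k → suc (a + k)) (sym (toℕ-inject₁ i))))
      ; close = adj-cong G
                  (cong (λ k → walk (a + k)) (sym (toℕ-fromℕ (2 + len))))
                  (trans (cong walk (sym (+-suc a (2 + len))))
                    (trans (sym closed) (cong walk (sym (+-identityʳ a)))))
                  (walk-adj (a + (2 + len)))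
      }

    Collision : ℕ → ℕ → Set
    Collision a len =
      ∃₂ λ (s t : Fin (3 + len)) → toℕ s < toℕ t × walk (a + toℕ s) ≡ walk (a + toℕ t)

    collision? : ∀ a len → Dec (Collision a len)
    collision? a len = any? λ s → any? λ t →
      (toℕ s <? toℕ t) ×-dec (walk (a + toℕ s) ≟F walk (a + toℕ t))

    -- The stretch from i to j cannot have length 1 (G is loopless) or 2 (the
    -- walk does not backtrack); if it is longer, it either contains a
    -- repetition ending before j or it is a cycle.
    Repeated : ℕ → Set
    Repeated j = ∀ i → i < j → walk i ≡ walk j → Cycle G S

    repetition⇒cycle : ∀ j → Repeated j
    repetition⇒cycle = <-rec Repeated stretch
      where
        stretch : ∀ j → (∀ {j'} → j' < j → Repeated j') → Repeated j
        stretch j rec i i<j same with m≤n⇒∃[o]m+o≡n i<j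
        ... | zero , refl = ⊥-elim $
          adj⇒≢ G (walk-adj i) (trans same (cong (λ k → walk (suc k)) (+-identityʳ i)))
        ... | suc zero , refl = ⊥-elim $
          no-backtrack i (sym (trans same (cong (λ k → walk (suc k)) (+-comm i 1))))
        ... | suc (suc len) , refl with collision? i len
        ... | yes (s , t , s<t , collision) =
          rec i+t<j (i + toℕ s) (+-monoʳ-< i s<t) collision
          where
            i+t<j : i + toℕ t < suc i + suc (suc len)
            i+t<j = subst (i + toℕ t <_) (+-suc i (suc (suc len))) (+-monoʳ-< i (toℕ<n t))
        ... | no no-collision = segment-cycle i len
          (trans same (cong walk (sym (+-suc i (suc (suc len))))))
          (collision-free⇒injective (λ t → walk (i + toℕ t))
            λ s t s<t eq → no-collision (s , t , s<t , eq))

  -- the first n + 1 positions of the walk visit only n vertices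
  minimum-degree-two⇒cycle : Nonempty P → Cycle G S
  minimum-degree-two⇒cycle (v₀ , v₀∈P) =
    let (i , j , i<j , same) = pigeonhole (n<1+n n) (λ (i : Fin (suc n)) → walk (toℕ i))
    in repetition⇒cycle (toℕ j) (toℕ i) i<j same
    where open NonBacktrackingWalk v₀ v₀∈P

record Matching (G : Graph n) (A Y : Subset n) (m : ℕ) : Set where
  field
    row col : Fin m → Fin n
    row∈    : ∀ i → row i ∈ A
    col∈    : ∀ i → col i ∈ Y
    matched : ∀ i → adj G (row i) (col i) ≡ true
    induced : ∀ i j → i ≢ j → adj G (row i) (col j) ≡ false

no-matching : {G : Graph n} {A Y : Subset n} → Matching G A Y 0
no-matching = record
  { row = λ () ; col = λ () ; row∈ = λ () ; col∈ = λ () ; matched = λ () ; induced = λ () }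

matching⇒cut-matching : {G : Graph n} {A Y S : Subset n} {m : ℕ} →
  A ⊆ S → Y ⊆ ∁ S → Matching G A Y m → InducedMatching G S m
matching⇒cut-matching A⊆S Y⊆∁S M =
  row , col , (λ i → A⊆S (row∈ i)) , (λ i → x∈∁p⇒x∉p (Y⊆∁S (col∈ i))) , matched , induced
  where open Matching M

Private : Graph n → Subset n → Fin n → Fin n → Set
Private G A b y = ∀ {a} → a ∈ A → adj G a y ≡ true → a ≡ b

Private-mono : {G : Graph n} {A A' : Subset n} {b y : Fin n} →
  A' ⊆ A → Private G A b y → Private G A' b y
Private-mono A'⊆A priv a∈A' = priv (A'⊆A a∈A')

private⇒¬HasTwo : {G : Graph n} {A : Subset n} {b y : Fin n} →
  Private G A b y → ¬ HasTwo (A ∩ N G y)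
private⇒¬HasTwo {n} {G} {A} {b} {y} priv (u , v , u≢v , u∈ , v∈) =
  u≢v (trans (side u∈) (sym (side v∈)))
  where
    side : {a : Fin n} → a ∈ A ∩ N G y → a ≡ b
    side a∈ = let (a∈A , a∈Ny) = x∈p∩q⁻ A _ a∈ in
      priv a∈A (trans (adj-sym G _ y) (∈N⁻ G a∈Ny))

extend : {G : Graph n} {A Y A' Y' : Subset n} {m : ℕ} {a y : Fin n} →
  a ∈ A → y ∈ Y → adj G a y ≡ true → A' ⊆ A → Y' ⊆ Y → (∀ {a'} → a' ∈ A' → a' ≢ a) →
  Private G A a y → (∀ {y'} → y' ∈ Y' → adj G a y' ≡ true → Private G A a y') →
  Matching G A' Y' m → Matching G A Y (suc m)
extend {n} {G} {A} {Y} {A'} {Y'} {m} {a} {y}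
       a∈A y∈Y ay A'⊆A Y'⊆Y avoids-a y-private others-private M =
  record { row = row' ; col = col' ; row∈ = row∈' ; col∈ = col∈' ; matched = matched'
         ; induced = induced' }
  where
    module M = Matching M

    row' col' : Fin (suc m) → Fin n
    row' zero    = a
    row' (suc i) = M.row i
    col' zero    = y
    col' (suc i) = M.col i

    row∈' : ∀ i → row' i ∈ A
    row∈' zero    = a∈A
    row∈' (suc i) = A'⊆A (M.row∈ i)

    col∈' : ∀ i → col' i ∈ Y
    col∈' zero    = y∈Y
    col∈' (suc i) = Y'⊆Y (M.col∈ i)

    matched' : ∀ i → adj G (row' i) (col' i) ≡ true
    matched' zero    = ay
    matched' (suc i) = M.matched i

    induced' : ∀ i j → i ≢ j → adj G (row' i) (col' j) ≡ false
    induced' zero    zero    i≢j = contradiction refl i≢j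
    induced' zero    (suc j) _   = ¬-not λ a~col →
      avoids-a (M.row∈ j) (others-private (M.col∈ j) a~col (A'⊆A (M.row∈ j)) (M.matched j))
    induced' (suc i) zero    _   = ¬-not λ row~y →
      avoids-a (M.row∈ i) (y-private (A'⊆A (M.row∈ i)) row~y)
    induced' (suc i) (suc j) i≢j = M.induced i j (λ i≡j → i≢j (cong suc i≡j))

-- During the recursion a vertex of A
-- may lose Y-neighbours, so the invariant is weaker: every b ∈ A is "good",
-- i.e. has two Y-neighbours, or has a Y-neighbour and all its Y-neighbours
-- are private to b.

module MatchingInForest (G : Graph n) (S : Subset n) (forest : IsForest G S) where

  AllPrivate : Subset n → Subset n → Fin n → Set
  AllPrivate A Y b = ∀ {y} → y ∈ Y ∩ N G b → Private G A b y

  Good : Subset n → Subset n → Fin n → Set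
  Good A Y b = HasTwo (Y ∩ N G b) ⊎ (Nonempty (Y ∩ N G b) × AllPrivate A Y b)

  Result : Subset n → Subset n → Set
  Result A Y = ∃ λ m → Matching G A Y m × ∣ A ∣ ≤ 2 * m

  Good-restrict : ∀ {A Y A' Y' b} → A' ⊆ A → Y ∩ N G b ⊆ Y' → Y' ⊆ Y →
    Good A Y b → Good A' Y' b
  Good-restrict {A} {Y} {A'} {Y'} {b} A'⊆A keep Y'⊆Y good =
    map-⊎ (HasTwo-mono keep') (λ (nb , priv) → (proj₁ nb , keep' (proj₂ nb)) , priv' priv)
      good
    where
      keep' : Y ∩ N G b ⊆ Y' ∩ N G b
      keep' y∈ = x∈p∩q⁺ (keep y∈ , proj₂ (x∈p∩q⁻ Y _ y∈))
      priv' : AllPrivate A Y b → AllPrivate A' Y' b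
      priv' priv {y} y∈ = Private-mono {G = G} A'⊆A (priv (∩-monoˡ Y'⊆Y y∈))

  Shared : Subset n → Subset n → Subset n
  Shared A Y = ⟦ (λ y → (y ∈? Y) ×-dec HasTwo? (A ∩ N G y)) ⟧

  shared⁺ : ∀ {A Y y} → y ∈ Y → HasTwo (A ∩ N G y) → y ∈ Shared A Y
  shared⁺ {A} {Y} y∈Y two = ∈⟦⟧⁺ {P? = λ y → (y ∈? Y) ×-dec HasTwo? (A ∩ N G y)} (y∈Y , two)

  shared⁻ : ∀ {A Y y} → y ∈ Shared A Y → y ∈ Y × HasTwo (A ∩ N G y)
  shared⁻ {A} {Y} = ∈⟦⟧⁻ {P? = λ y → (y ∈? Y) ×-dec HasTwo? (A ∩ N G y)}

  good-near-shared : ∀ {A Y b z} → Good A Y b → z ∈ Y ∩ N G b → z ∈ Shared A Y →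
    HasTwo (Y ∩ N G b)
  good-near-shared (inj₁ two)         _   _        = two
  good-near-shared (inj₂ (_ , priv)) z∈ z-shared =
    contradiction (proj₂ (shared⁻ z-shared)) (private⇒¬HasTwo {G = G} (priv z∈))

  -- Peeling the edge a — y: if the matching on A ∖ ({a} ∪ W) and Y' ⊆ Y has
  -- at least half as many edges as its rows, then adding a — y restores this
  -- for A, since at most two rows were dropped.
  peel : ∀ {A Y Y' W a y} → a ∈ A → y ∈ Y ∩ N G a → Y' ⊆ Y → ∣ W ∣ ≤ 1 →
    Private G A a y → (∀ {y'} → y' ∈ Y' → adj G a y' ≡ true → Private G A a y') →
    Result (remove A a W) Y' → Result A Y
  peel {A} {Y} {Y'} {W} {a} {y} a∈A y∈ Y'⊆Y ∣W∣≤1 y-private others-private (m , M , bound) =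
    suc m ,
    extend a∈A (proj₁ (x∈p∩q⁻ Y _ y∈)) (∈N⁻ G (proj₂ (x∈p∩q⁻ Y _ y∈)))
      (λ b∈ → proj₁ (remove⁻ A W b∈)) Y'⊆Y (λ b∈ → proj₁ (proj₂ (remove⁻ A W b∈)))
      y-private others-private M ,
    (begin
      ∣ A ∣                      ≤⟨ remove-≤ a ∣W∣≤1 ⟩
      ∣ remove A a W ∣ + 2       ≤⟨ +-monoˡ-≤ 2 bound ⟩
      2 * m + 2                  ≡⟨ +-comm (2 * m) 2 ⟩
      2 + 2 * m                  ≡⟨ *-suc 2 m ⟨
      2 * suc m                  ∎)
    where open ≤-Reasoning

  -- If no Y-vertex is shared (has two A-neighbours), any a ∈ A is peeled.
  -- Otherwise a shared vertex with at most one branching neighbour exists,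
  -- and a non-branching neighbour of it is peeled.
  module Step (A Y : Subset n) (A⊆S : A ⊆ S) (Y⊆S : Y ⊆ S)
              (good : ∀ {b} → b ∈ A → Good A Y b)
              (recurse : ∀ {A' Y'} → ∣ A' ∣ < ∣ A ∣ → A' ⊆ A → Y' ⊆ Y →
                         (∀ {b} → b ∈ A' → Good A' Y' b) → Result A' Y') where

    private-or-shared : ∀ {b y a'} → b ∈ A → y ∈ Y ∩ N G b → a' ∈ A → adj G a' y ≡ true →
      a' ≡ b ⊎ y ∈ Shared A Y
    private-or-shared {b} {y} {a'} b∈A y∈ a'∈A a'y with a' ≟F b
    ... | yes a'≡b = inj₁ a'≡b
    ... | no a'≢b  = inj₂ (shared⁺ (proj₁ (x∈p∩q⁻ Y _ y∈))
            (a' , b , a'≢b , x∈p∩q⁺ (a'∈A , ∈N⁺ G (trans (adj-sym G y a') a'y)) ,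
                             x∈p∩q⁺ (b∈A , ∈N-sym G (proj₂ (x∈p∩q⁻ Y _ y∈)))))

    peel-private : ∀ {a} → a ∈ A → Empty (Shared A Y) → Result A Y
    peel-private {a} a∈A none =
      peel a∈A (proj₂ neighbour) (λ y∈ → y∈) ∣⊥∣≤1 (all-private (proj₂ neighbour))
        (λ y∈Y ay → all-private (x∈p∩q⁺ (y∈Y , ∈N⁺ G ay)))
        (recurse (remove-< a∈A) A'⊆A (λ y∈ → y∈) good')
      where
        A'⊆A : remove A a ⊥ ⊆ A
        A'⊆A b∈ = proj₁ (remove⁻ A ⊥ b∈)
        ∣⊥∣≤1 : ∣ ⊥ {n = n} ∣ ≤ 1
        ∣⊥∣≤1 = subst (_≤ 1) (sym (∣⊥∣≡0 n)) z≤n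
        neighbour : Nonempty (Y ∩ N G a)
        neighbour with good a∈A
        ... | inj₁ (y , _ , _ , y∈ , _) = y , y∈
        ... | inj₂ (nb , _)             = nb
        all-private : AllPrivate A Y a
        all-private y∈ a'∈A a'y with private-or-shared a∈A y∈ a'∈A a'y
        ... | inj₁ a'≡a     = a'≡a
        ... | inj₂ y-shared = contradiction (_ , y-shared) none
        good' : ∀ {b} → b ∈ remove A a ⊥ → Good (remove A a ⊥) Y b
        good' {b} b∈ = Good-restrict A'⊆A (p∩q⊆p Y (N G b)) (λ y∈ → y∈) (good (A'⊆A b∈))

    Branching : Subset n
    Branching = ⟦ (λ a → (a ∈? A) ×-dec HasTwo? (Shared A Y ∩ N G a)) ⟧

    branching⁺ : ∀ {a} → a ∈ A → HasTwo (Shared A Y ∩ N G a) → a ∈ Branching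
    branching⁺ a∈A two = ∈⟦⟧⁺ {P? = λ a → (a ∈? A) ×-dec HasTwo? (Shared A Y ∩ N G a)} (a∈A , two)

    branching⁻ : ∀ {a} → a ∈ Branching → a ∈ A × HasTwo (Shared A Y ∩ N G a)
    branching⁻ = ∈⟦⟧⁻ {P? = λ a → (a ∈? A) ×-dec HasTwo? (Shared A Y ∩ N G a)}

    -- Some shared vertex has at most one branching neighbour: otherwise the
    -- branching and shared vertices would span a subgraph of minimum degree two.
    sparse-shared : Nonempty (Shared A Y) →
      ∃ λ z → z ∈ Shared A Y × ¬ HasTwo (Branching ∩ N G z)
    sparse-shared (z₀ , z₀-shared)
      with any? (λ z → (z ∈? Shared A Y) ×-dec ¬? (HasTwo? (Branching ∩ N G z)))
    ... | yes found = found
    ... | no none   = ⊥-elim (forest (minimum-degree-two⇒cycle (z₀ , q⊆p∪q Branching _ z₀-shared)))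
      where
        P⊆S : Branching ∪ Shared A Y ⊆ S
        P⊆S v∈ with x∈p∪q⁻ Branching _ v∈
        ... | inj₁ v∈B  = A⊆S (proj₁ (branching⁻ v∈B))
        ... | inj₂ v∈Sh = Y⊆S (proj₁ (shared⁻ v∈Sh))
        degree : ∀ {v} → v ∈ Branching ∪ Shared A Y → HasTwo ((Branching ∪ Shared A Y) ∩ N G v)
        degree {v} v∈ with x∈p∪q⁻ Branching _ v∈
        ... | inj₁ v∈B  = HasTwo-mono (∩-monoˡ (q⊆p∪q Branching _)) (proj₂ (branching⁻ v∈B))
        ... | inj₂ v∈Sh with HasTwo? (Branching ∩ N G v)
        ...   | yes two  = HasTwo-mono (∩-monoˡ (p⊆p∪q _)) two
        ...   | no ¬two  = contradiction (v , v∈Sh , ¬two) none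
        open MinimumDegreeTwo G S (Branching ∪ Shared A Y) P⊆S degree

    -- For a non-branching b next to a shared z, every other Y-neighbour y of b
    -- is private: a second A-neighbour would make y shared and b branching.
    private-beside : ∀ {b z y} → b ∈ A → b ∉ Branching → z ∈ Shared A Y → z ∈ N G b →
      y ∈ Y ∩ N G b → y ≢ z → Private G A b y
    private-beside b∈A b∉B z-shared z∈Nb y∈ y≢z a'∈A a'y
      with private-or-shared b∈A y∈ a'∈A a'y
    ... | inj₁ a'≡b     = a'≡b
    ... | inj₂ y-shared = contradiction
      (branching⁺ b∈A (_ , _ , y≢z , x∈p∩q⁺ (y-shared , proj₂ (x∈p∩q⁻ Y _ y∈)) ,
                                     x∈p∩q⁺ (z-shared , z∈Nb)))
      b∉B

    -- Peel a
    -- non-branching neighbour a of z, matched to a Y-neighbour other than z,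
    -- and drop z from Y and the branching neighbour of z (if any) from A.
    peel-shared : ∀ {z} → z ∈ Shared A Y → ¬ HasTwo (Branching ∩ N G z) → Result A Y
    peel-shared {z} z-shared few =
      peel a∈A (proj₁ (proj₂ partner)) Y'⊆Y (¬HasTwo⇒∣p∣≤1 few)
        (private-beside a∈A a∉B z-shared z∈Na (proj₁ (proj₂ partner)) (proj₂ (proj₂ partner)))
        (λ y'∈ ay' → let (y'∈Y , y'≢z , _) = remove⁻ Y ⊥ y'∈ in
          private-beside a∈A a∉B z-shared z∈Na (x∈p∩q⁺ (y'∈Y , ∈N⁺ G ay')) y'≢z)
        (recurse (remove-< a∈A) A'⊆A Y'⊆Y good')
      where
        z∈Y : z ∈ Y
        z∈Y = proj₁ (shared⁻ z-shared)

        non-branching : ∃ λ a → a ∈ A ∩ N G z × a ∉ Branching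
        non-branching with proj₂ (shared⁻ z-shared)
        ... | (u , v , u≢v , u∈ , v∈) with u ∈? Branching | v ∈? Branching
        ...   | no u∉B  | _       = u , u∈ , u∉B
        ...   | yes _   | no v∉B  = v , v∈ , v∉B
        ...   | yes u∈B | yes v∈B = contradiction
          (u , v , u≢v , x∈p∩q⁺ (u∈B , proj₂ (x∈p∩q⁻ A _ u∈)) ,
                         x∈p∩q⁺ (v∈B , proj₂ (x∈p∩q⁻ A _ v∈))) few

        a : Fin n
        a = proj₁ non-branching
        a∈A : a ∈ A
        a∈A = proj₁ (x∈p∩q⁻ A _ (proj₁ (proj₂ non-branching)))
        z∈Na : z ∈ N G a
        z∈Na = ∈N-sym G (proj₂ (x∈p∩q⁻ A _ (proj₁ (proj₂ non-branching))))
        a∉B : a ∉ Branching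
        a∉B = proj₂ (proj₂ non-branching)

        partner : ∃ λ y → y ∈ Y ∩ N G a × y ≢ z
        partner = other (good-near-shared (good a∈A) (x∈p∩q⁺ (z∈Y , z∈Na)) z-shared) z

        A' Y' : Subset n
        A' = remove A a (Branching ∩ N G z)
        Y' = remove Y z ⊥

        A'⊆A : A' ⊆ A
        A'⊆A b∈ = proj₁ (remove⁻ A _ b∈)
        Y'⊆Y : Y' ⊆ Y
        Y'⊆Y y∈ = proj₁ (remove⁻ Y ⊥ y∈)

        -- the invariant survives: a remaining b next to z is not branching (else
        -- it was removed), so its Y-neighbours other than z are private and one
        -- of them remains; a remaining b not next to z keeps all its Y-neighbours
        good' : ∀ {b} → b ∈ A' → Good A' Y' b
        good' {b} b∈ with remove⁻ A _ b∈ | z ∈? N G b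
        ... | b∈A , _ , _ | no z∉Nb = Good-restrict A'⊆A keep Y'⊆Y (good b∈A)
          where
            keep : Y ∩ N G b ⊆ Y'
            keep y∈ = let (y∈Y , y∈Nb) = x∈p∩q⁻ Y _ y∈ in
              remove⁺ y∈Y (λ { refl → z∉Nb y∈Nb }) ∉⊥
        ... | b∈A , _ , b∉W | yes z∈Nb
          with other (good-near-shared (good b∈A) (x∈p∩q⁺ (z∈Y , z∈Nb)) z-shared) z
        ...   | y , y∈ , y≢z =
          let (y∈Y , y∈Nb) = x∈p∩q⁻ Y _ y∈ in
          inj₂ ((y , x∈p∩q⁺ (remove⁺ y∈Y y≢z ∉⊥ , y∈Nb)) , all-private)
          where
            b∉B : b ∉ Branching
            b∉B b∈B = b∉W (x∈p∩q⁺ (b∈B , ∈N-sym G z∈Nb))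
            all-private : AllPrivate A' Y' b
            all-private y'∈ = Private-mono {G = G} A'⊆A
              (private-beside b∈A b∉B z-shared z∈Nb (∩-monoˡ Y'⊆Y y'∈)
                (proj₁ (proj₂ (remove⁻ Y ⊥ (proj₁ (x∈p∩q⁻ _ _ y'∈))))))

    peel-some : Nonempty A → Result A Y
    peel-some (a , a∈A) with nonempty? (Shared A Y)
    ... | no none  = peel-private a∈A none
    ... | yes some = let (z , z-shared , few) = sparse-shared some in peel-shared z-shared few

  matching : ∀ fuel {A Y} → ∣ A ∣ ≤ fuel → A ⊆ S → Y ⊆ S →
    (∀ {b} → b ∈ A → Good A Y b) → Result A Y
  matching zero       ∣A∣≤0 _ _ _ = 0 , no-matching , ∣A∣≤0
  matching (suc fuel) {A} {Y} ∣A∣≤fuel A⊆S Y⊆S good with nonempty? A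
  ... | no empty = 0 , no-matching , ≤-reflexive (Empty⇒∣p∣≡0 empty)
  ... | yes some = Step.peel-some A Y A⊆S Y⊆S good
    (λ smaller A'⊆A Y'⊆Y good' → matching fuel (≤-pred (≤-trans smaller ∣A∣≤fuel))
       (⊆-trans A'⊆A A⊆S) (⊆-trans Y'⊆Y Y⊆S) good')
    some

  forest-matching : ∀ {A Y} → A ⊆ S → Y ⊆ S → (∀ {b} → b ∈ A → HasTwo (Y ∩ N G b)) →
    ∃ λ m → Matching G A Y m × ∣ A ∣ ≤ 2 * m
  forest-matching A⊆S Y⊆S two = matching _ ≤-refl A⊆S Y⊆S (λ b∈ → inj₁ (two b∈))

bigop-unit : ∀ {A : Set} {m} (_∙_ : A → A → A) (e : A) → (∀ x → e ∙ x ≡ x) →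
  (f : Fin m → A) → (∀ i → f i ≡ e) → bigop _∙_ e f ≡ e
bigop-unit {m = zero}  _∙_ e identityˡ f units = refl
bigop-unit {m = suc m} _∙_ e identityˡ f units =
  trans (cong (_∙ bigop _∙_ e (λ i → f (suc i))) (units zero))
    (trans (identityˡ _) (bigop-unit _∙_ e identityˡ (λ i → f (suc i)) (λ i → units (suc i))))

bigop-single : ∀ {A : Set} {m} (_∙_ : A → A → A) (e : A) →
  (∀ x → e ∙ x ≡ x) → (∀ x → x ∙ e ≡ x) →
  (f : Fin m → A) (p : Fin m) → (∀ i → i ≢ p → f i ≡ e) → bigop _∙_ e f ≡ f p
bigop-single _∙_ e identityˡ identityʳ f zero units =
  trans (cong (f zero ∙_) (bigop-unit _∙_ e identityˡ _ (λ i → units (suc i) (λ ()))))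
    (identityʳ (f zero))
bigop-single _∙_ e identityˡ identityʳ f (suc p) units =
  trans (cong (_∙ bigop _∙_ e (λ i → f (suc i))) (units zero (λ ())))
    (trans (identityˡ _) (bigop-single _∙_ e identityˡ identityʳ (λ i → f (suc i)) p
      (λ i i≢p → units (suc i) (λ eq → i≢p (fsuc-injective eq)))))

xor-identityʳ : ∀ x → x xor false ≡ x
xor-identityʳ false = refl
xor-identityʳ true  = refl

funToFin-cong : ∀ {m k} {f g : Fin m → Fin k} → (∀ i → f i ≡ g i) → funToFin f ≡ funToFin g
funToFin-cong {zero}  eq = refl
funToFin-cong {suc m} eq = cong₂ combine (eq zero) (funToFin-cong (λ i → eq (suc i)))

module CutMatching {G : Graph n} {S : Subset n} {m : ℕ} (M : InducedMatching G S m) where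

  row col : Fin m → Fin n
  row = proj₁ M
  col = proj₁ (proj₂ M)

  row∈S : ∀ i → row i ∈ S
  row∈S = proj₁ (proj₂ (proj₂ M))

  col∉S : ∀ i → col i ∉ S
  col∉S = proj₁ (proj₂ (proj₂ (proj₂ M)))

  matched : ∀ i → adj G (row i) (col i) ≡ true
  matched = proj₁ (proj₂ (proj₂ (proj₂ (proj₂ M))))

  induced : ∀ i j → i ≢ j → adj G (row i) (col j) ≡ false
  induced = proj₂ (proj₂ (proj₂ (proj₂ (proj₂ M))))

  mim-bound : ∀ {k} → IsMim G S k → m ≤ k
  mim-bound (_ , maximal) = maximal m M

  row-injective : ∀ i j → row i ≡ row j → i ≡ j
  row-injective i j eq with i ≟F j
  ... | yes i≡j = i≡j
  ... | no i≢j  with trans (sym (induced i j i≢j)) (adj-cong G (sym eq) refl (matched j))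
  ...   | ()

  Rows : Subset n
  Rows = ⟦ (λ v → any? λ i → row i ≟F v) ⟧

  row∈Rows : ∀ i → row i ∈ Rows
  row∈Rows i = ∈⟦⟧⁺ {P? = λ v → any? λ i → row i ≟F v} (i , refl)

  Rows⁻ : ∀ {v} → v ∈ Rows → ∃ λ i → row i ≡ v
  Rows⁻ = ∈⟦⟧⁻ {P? = λ v → any? λ i → row i ≟F v}

  Rows⊆S : Rows ⊆ S
  Rows⊆S v∈ with Rows⁻ v∈
  ... | i , refl = row∈S i

  m≤∣Rows∣ : m ≤ ∣ Rows ∣
  m≤∣Rows∣ = injection⇒≤∣p∣ row row-injective row∈Rows

  column-diag : ∀ i → lookup Rows (row i) ∧ adj G (row i) (col i) ≡ true
  column-diag i = cong₂ _∧_ ([]=⇒lookup (row∈Rows i)) (matched i)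

  column-off : ∀ i u → u ≢ row i → lookup Rows u ∧ adj G u (col i) ≡ false
  column-off i u u≢row with lookup Rows u in eq
  ... | false = refl
  ... | true  with Rows⁻ (lookup⇒[]= u Rows eq)
  ...   | j , refl = induced j i (λ j≡i → u≢row (cong row j≡i))

  independent-GF2 : IndepGF2 G S Rows
  independent-GF2 = Rows⊆S , λ c zero-sums v v∈ →
    let (i , row-i≡v) = Rows⁻ v∈ in
    subst (λ u → c u ≡ false) row-i≡v (trans (sym (column-sum c i)) (zero-sums (col i) (col∉S i)))
    where
      column-sum : ∀ c i → bigop _xor_ false (λ u → c u ∧ lookup Rows u ∧ adj G u (col i)) ≡ c (row i)
      column-sum c i =
        trans (bigop-single _xor_ false (λ _ → refl) xor-identityʳ _ (row i)
                (λ u u≢row → trans (cong (c u ∧_) (column-off i u u≢row)) (∧-zeroʳ (c u))))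
              (trans (cong (c (row i) ∧_) (column-diag i)) (∧-identityʳ (c (row i))))

  independent-ℚ : Indepℚ G S Rows
  independent-ℚ = Rows⊆S , λ c zero-sums v v∈ →
    let (i , row-i≡v) = Rows⁻ v∈ in
    subst (λ u → c u ≡ 0ℚ) row-i≡v (trans (sym (column-sum c i)) (zero-sums (col i) (col∉S i)))
    where
      column-sum : ∀ c i →
        bigop _+ℚ_ 0ℚ (λ u → if lookup Rows u ∧ adj G u (col i) then c u else 0ℚ) ≡ c (row i)
      column-sum c i =
        trans (bigop-single _+ℚ_ 0ℚ ℚ.+-identityˡ ℚ.+-identityʳ _ (row i)
                (λ u u≢row → cong (λ b → if b then c u else 0ℚ) (column-off i u u≢row)))
              (cong (λ b → if b then c (row i) else 0ℚ) (column-diag i))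

  rw-bound : ∀ {r} → IsRw G S r → m ≤ r
  rw-bound (_ , maximal) = ≤-trans m≤∣Rows∣ (maximal Rows independent-GF2)

  rwℚ-bound : ∀ {r} → IsRwℚ G S r → m ≤ r
  rwℚ-bound (_ , maximal) = ≤-trans m≤∣Rows∣ (maximal Rows independent-ℚ)

  Selected : (Fin m → Fin 2) → Subset n
  Selected z = ⟦ (λ v → any? λ i → (row i ≟F v) ×-dec (z i ≟F suc zero)) ⟧

  Selected⁺ : ∀ z i → z i ≡ suc zero → row i ∈ Selected z
  Selected⁺ z i zi≡1 = ∈⟦⟧⁺ {P? = λ v → any? λ i → (row i ≟F v) ×-dec (z i ≟F suc zero)} (i , refl , zi≡1)

  Selected⁻ : ∀ z {v} → v ∈ Selected z → ∃ λ i → row i ≡ v × z i ≡ suc zero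
  Selected⁻ z = ∈⟦⟧⁻ {P? = λ v → any? λ i → (row i ≟F v) ×-dec (z i ≟F suc zero)}

  Selected⊆S : ∀ z → Selected z ⊆ S
  Selected⊆S z v∈ with Selected⁻ z v∈
  ... | i , refl , _ = row∈S i

  selected-trace : ∀ z j → 1 ⊓ ∣ Selected z ∩ N G (col j) ∣ ≡ toℕ (z j)
  selected-trace z j with z j in zj
  ... | zero = cong (1 ⊓_) (Empty⇒∣p∣≡0 nothing-seen)
    where
      nothing-seen : Empty (Selected z ∩ N G (col j))
      nothing-seen (v , v∈) with x∈p∩q⁻ (Selected z) _ v∈
      ... | v∈Sel , v∈N with Selected⁻ z v∈Sel
      ...   | i , refl , zi≡1 with i ≟F j
      ...     | yes refl = case trans (sym zj) zi≡1 of λ ()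
      ...     | no i≢j  = case trans (sym (induced i j i≢j)) (trans (adj-sym G (row i) (col j)) (∈N⁻ G v∈N)) of λ ()
  ... | suc zero = m≤n⇒m⊓n≡m (∈⇒1≤∣p∣ (x∈p∩q⁺ (Selected⁺ z j zj ,
                     ∈N⁺ G (trans (adj-sym G (col j) (row j)) (matched j)))))

  -- distinct selections lie in distinct ≡¹_S classes, so there are at least 2^m classes
  nec1-bound : ∀ {k} → IsNec1 G S k → 2 ^ m ≤ k
  nec1-bound {k} (rep , _ , _ , cover) = injective⇒≤ {f = class ∘ decode} class-injective
    where
      decode : Fin (2 ^ m) → (Fin m → Fin 2)
      decode = finToFun {2} {m}
      encode : (Fin m → Fin 2) → Fin (2 ^ m)
      encode = funToFin {m} {2}

      class : (Fin m → Fin 2) → Fin k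
      class z = proj₁ (cover (Selected z) (Selected⊆S z))

      same-class : ∀ z z' → class z ≡ class z' → ∀ j → z j ≡ z' j
      same-class z z' eq j = toℕ-injective (begin
        toℕ (z j)                                       ≡⟨ selected-trace z j ⟨
        1 ⊓ ∣ Selected z ∩ N G (col j) ∣                ≡⟨ proj₂ (cover (Selected z) _) (col j) (col∉S j) ⟩
        1 ⊓ ∣ rep (class z) ∩ N G (col j) ∣             ≡⟨ cong (λ i → 1 ⊓ ∣ rep i ∩ N G (col j) ∣) eq ⟩
        1 ⊓ ∣ rep (class z') ∩ N G (col j) ∣            ≡⟨ proj₂ (cover (Selected z') _) (col j) (col∉S j) ⟨
        1 ⊓ ∣ Selected z' ∩ N G (col j) ∣               ≡⟨ selected-trace z' j ⟩
        toℕ (z' j)                                      ∎)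
        where open ≡-Reasoning

      class-injective : ∀ {t t'} → class (decode t) ≡ class (decode t') → t ≡ t'
      class-injective {t} {t'} eq = begin
        t                    ≡⟨ funToFin-finToFin {m} {2} t ⟨
        encode (decode t)    ≡⟨ funToFin-cong (same-class _ _ eq) ⟩
        encode (decode t')   ≡⟨ funToFin-finToFin {m} {2} t' ⟩
        t'                        ∎
        where open ≡-Reasoning

forest-mono : {G : Graph n} {S T : Subset n} → S ⊆ T → IsForest G T → IsForest G S
forest-mono S⊆T T-forest C = T-forest (record
  { len = C.len ; c = C.c ; inj = C.inj ; inS = λ i → S⊆T (C.inS i) ; step = C.step
  ; close = C.close })
  where module C = Cycle C

square : {G : Graph n} {S : Subset n} {a y b y' : Fin n} → a ≢ b → y ≢ y' →
  a ∈ S → y ∈ S → b ∈ S → y' ∈ S →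
  adj G a y ≡ true → adj G y b ≡ true → adj G b y' ≡ true → adj G y' a ≡ true → Cycle G S
square {n} {G} {S} {a} {y} {b} {y'} a≢b y≢y' a∈ y∈ b∈ y'∈ ay yb by' y'a = record
  { len = 1 ; c = c ; inj = collision-free⇒injective c distinct ; inS = inS
  ; step = steps ; close = y'a }
  where
    c : Fin 4 → Fin n
    c zero                   = a
    c (suc zero)             = y
    c (suc (suc zero))       = b
    c (suc (suc (suc zero))) = y'

    distinct : ∀ s t → toℕ s < toℕ t → c s ≢ c t
    distinct zero             (suc zero)                   _ = adj⇒≢ G ay
    distinct zero             (suc (suc zero))             _ = a≢b
    distinct zero             (suc (suc (suc zero)))       _ = λ a≡y' → adj⇒≢ G y'a (sym a≡y')
    distinct (suc zero)       (suc (suc zero))             _ = adj⇒≢ G yb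
    distinct (suc zero)       (suc (suc (suc zero)))       _ = y≢y'
    distinct (suc (suc zero)) (suc (suc (suc zero)))       _ = adj⇒≢ G by'
    distinct zero             zero                         ()
    distinct (suc zero)       zero                         ()
    distinct (suc zero)       (suc zero)                   (s≤s ())
    distinct (suc (suc zero)) zero                         ()
    distinct (suc (suc zero)) (suc zero)                   (s≤s ())
    distinct (suc (suc zero)) (suc (suc zero))             (s≤s (s≤s ()))
    distinct (suc (suc (suc zero))) zero                   ()
    distinct (suc (suc (suc zero))) (suc zero)             (s≤s ())
    distinct (suc (suc (suc zero))) (suc (suc zero))       (s≤s (s≤s ()))
    distinct (suc (suc (suc zero))) (suc (suc (suc zero))) (s≤s (s≤s (s≤s ())))

    inS : ∀ i → c i ∈ S
    inS zero                   = a∈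
    inS (suc zero)             = y∈
    inS (suc (suc zero))       = b∈
    inS (suc (suc (suc zero))) = y'∈

    steps : ∀ (i : Fin 3) → adj G (c (inject₁ i)) (c (suc i)) ≡ true
    steps zero             = ay
    steps (suc zero)       = yb
    steps (suc (suc zero)) = by'

X2+⁻ : {G : Graph n} {R' X : Subset n} {v : Fin n} →
  v ∈ X2+ G R' X → v ∈ X × 2 ≤ ∣ N G v ∩ R' ∣
X2+⁻ {G = G} {R'} {X} {v} v∈ with lookup X v in X-v | ∣ N G v ∩ R' ∣ | ∈-tabulate⁻ v∈
... | true  | suc (suc _) | _ = lookup⇒[]= v X X-v , s≤s (s≤s z≤n)
... | true  | zero        | ()
... | true  | suc zero    | ()
... | false | _           | ()

two-neighbours-transfer : {G : Graph n} {V Y R' : Subset n} {v : Fin n} → v ∈ V →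
  NeqEquiv G 2 (∁ V) Y R' → 2 ≤ ∣ R' ∩ N G v ∣ → HasTwo (Y ∩ N G v)
two-neighbours-transfer v∈V Y≡R' 2≤ =
  2≤∣p∣⇒HasTwo (m⊓n≡m⇒m≤n (trans (Y≡R' _ (x∈p⇒x∉∁p v∈V)) (m≤n⇒m⊓n≡m 2≤)))

X2+-two-neighbours : {G : Graph n} {V Y R' X : Subset n} {v : Fin n} → X ⊆ V →
  NeqEquiv G 2 (∁ V) Y R' → v ∈ X2+ G R' X → HasTwo (Y ∩ N G v)
X2+-two-neighbours {G = G} {R' = R'} {X} {v} X⊆V Y≡R' v∈ =
  let (v∈X , 2≤) = X2+⁻ {G = G} {R'} {X} v∈ in
  two-neighbours-transfer {G = G} {R' = R'} (X⊆V v∈X) Y≡R'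
    (subst (2 ≤_) (cong ∣_∣ (∩-comm (N G v) R')) 2≤)

-- In a forest G[S], distinct a, b ∈ S with the same neighbourhood in V̄
-- cannot exist when a has two neighbours in some Y ⊆ S ∩ V̄: they would be
-- two common neighbours of a and b, closing a 4-cycle.
distinct-traces : {G : Graph n} {S Y V : Subset n} {a b : Fin n} → IsForest G S →
  Y ⊆ S → Y ⊆ ∁ V → a ∈ S → b ∈ S → HasTwo (Y ∩ N G a) → a ≢ b →
  N G a ∩ ∁ V ≢ N G b ∩ ∁ V
distinct-traces {G = G} {S} {Y} {V} {a} {b} forest Y⊆S Y⊆∁V a∈S b∈S
                (y , y' , y≢y' , y∈ , y'∈) a≢b same-trace =
  let (y∈S , ay , yb) = common y∈ ; (y'∈S , ay' , y'b) = common y'∈ in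
  forest (square a≢b y≢y' a∈S y∈S b∈S y'∈S
    ay yb (trans (adj-sym G b _) y'b) (trans (adj-sym G _ a) ay'))
  where
    common : ∀ {u} → u ∈ Y ∩ N G a → u ∈ S × adj G a u ≡ true × adj G u b ≡ true
    common {u} u∈ =
      let (u∈Y , u∈Na) = x∈p∩q⁻ Y _ u∈
          u∈Nb = proj₁ (x∈p∩q⁻ (N G b) _ (subst (u ∈_) same-trace (x∈p∩q⁺ (u∈Na , Y⊆∁V u∈Y))))
      in Y⊆S u∈Y , ∈N⁻ G u∈Na , trans (adj-sym G u b) (∈N⁻ G u∈Nb)

pow-double : ∀ {a m k} → a ≤ 2 * m → 2 ^ m ≤ k → 2 ^ a ≤ k ^ 2
pow-double {a} {m} {k} a≤2m 2^m≤k = begin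
  2 ^ a          ≤⟨ ^-monoʳ-≤ 2 a≤2m ⟩
  2 ^ (2 * m)    ≡⟨ cong (2 ^_) (*-comm 2 m) ⟩
  2 ^ (m * 2)    ≡⟨ ^-*-assoc 2 m 2 ⟨
  (2 ^ m) ^ 2    ≤⟨ ^-monoˡ-≤ 2 2^m≤k ⟩
  k ^ 2          ∎
  where open ≤-Reasoning

lemma6p6 : ∀ {n} (G : Graph n) (L : Layout n) (x : Node (tree L)) (R' X : Subset n) →
    R' ⊆ ∁ (V L x) →
    Important G L x R' X →
    IsForest G X
    × (∀ a b → a ∈ X2+ G R' X → b ∈ X2+ G R' X → a ≢ b →
         N G a ∩ ∁ (V L x) ≢ N G b ∩ ∁ (V L x))
    × (∀ m → IsMim G (V L x) m → ∣ X2+ G R' X ∣ ≤ 2 * m)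
    × (∀ r → IsRw G (V L x) r → ∣ X2+ G R' X ∣ ≤ 2 * r)
    × (∀ r → IsRwℚ G (V L x) r → ∣ X2+ G R' X ∣ ≤ 2 * r)
    × (∀ k → IsNec1 G (V L x) k → 2 ^ ∣ X2+ G R' X ∣ ≤ k ^ 2)
lemma6p6 {n} G L x R' X _ (X⊆Vx , Y , Y⊆∁Vx , Y≡R' , _ , XY-forest) =
    forest-mono {G = G} (p⊆p∪q Y) XY-forest
  , (λ a b a∈ b∈ → distinct-traces XY-forest (q⊆p∪q X Y) Y⊆∁Vx (A⊆X∪Y a∈) (A⊆X∪Y b∈) (two a∈))
  , (λ m mim → ≤-trans bound (*-monoʳ-≤ 2 (mim-bound mim)))
  , (λ r rw → ≤-trans bound (*-monoʳ-≤ 2 (rw-bound rw)))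
  , (λ r rwℚ → ≤-trans bound (*-monoʳ-≤ 2 (rwℚ-bound rwℚ)))
  , (λ k nec → pow-double {m = size} bound (nec1-bound nec))
  where
    A : Subset n
    A = X2+ G R' X

    A⊆X : A ⊆ X
    A⊆X a∈ = proj₁ (X2+⁻ {G = G} {R'} a∈)

    A⊆X∪Y : A ⊆ X ∪ Y
    A⊆X∪Y a∈ = p⊆p∪q Y (A⊆X a∈)

    two : ∀ {a} → a ∈ A → HasTwo (Y ∩ N G a)
    two = X2+-two-neighbours {G = G} {R' = R'} X⊆Vx Y≡R'

    open MatchingInForest G (X ∪ Y) XY-forest using (forest-matching)
    result : ∃ λ m → Matching G A Y m × ∣ A ∣ ≤ 2 * m
    result = forest-matching A⊆X∪Y (q⊆p∪q X Y) two
    size : ℕ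
    size = proj₁ result
    matching : Matching G A Y size
    matching = proj₁ (proj₂ result)
    bound : ∣ A ∣ ≤ 2 * size
    bound = proj₂ (proj₂ result)
    open CutMatching {G = G} (matching⇒cut-matching (λ a∈ → X⊆Vx (A⊆X a∈)) Y⊆∁Vx matching)
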